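{- Every graph $G$ on $12$ vertices with minimum degree at least $5$ that does not contain $K_{5,7}$ as a subgraph has a perfect matching. -}

module Defs where

open import Data.Nat using (ℕ; _≤_)
open import Data.Fin using (Fin)
open import Data.List using (filter; length; allFin)
open import Data.Product using (Σ; _×_)
open import Relation.Nullary using (¬_)
open import Relation.Binary.PropositionalEquality using (_≡_; _≢_)
open import Function.Definitions using (Injective)

record Graph (n : ℕ) : Set₁ where
  field
    Adj   : Fin n → Fin n → Set
    adj?  : ∀ u v → Relation.Nullary.Dec (Adj u v)
    sym   : ∀ {u v} → Adj u v → Adj v u
    irrefl : ∀ {v} → ¬ Adj v v

open Graph public

degree : ∀ {n} → Graph n → Fin n → ℕ
degree G v = length (filter (adj? G v) (allFin _))

MinDegree≥ : ∀ {n} → Graph n → ℕ → Set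
MinDegree≥ G d = ∀ v → d ≤ degree G v

ContainsK : ∀ {n} → Graph n → ℕ → ℕ → Set
ContainsK {n} G a b =
  Σ (Fin a → Fin n) λ f → Σ (Fin b → Fin n) λ g →
    Injective _≡_ _≡_ f × Injective _≡_ _≡_ g ×
    (∀ i j → f i ≢ g j) × (∀ i j → Adj G (f i) (g j))

-- A perfect matching: a fixed-point-free involution m with every v
-- adjacent to m v (the edges {v, m v} partition the vertex set).
PerfectMatching : ∀ {n} → Graph n → Set
PerfectMatching {n} G =
  Σ (Fin n → Fin n) λ m →
    (∀ v → m (m v) ≡ v) × (∀ v → Adj G v (m v))

-- Fin (n * 2) is split into n pairs of slots (i , true), (i , false); a labelling (permutation)
-- places the vertices in the slots, and pair i is matched when its two vertices are adjacent.
-- Labellings are only changed by exchanging two slots.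
-- General part (PairedMatching): if pairs 0 .. k-1 are matched and pair k = {u , v} is not, one
-- exchange matches pair k as well, unless no later pair meets {u , v} and no earlier pair forms a
-- "crossing" with it; then deg u + deg v ≤ 2k.  So matchings grow to the minimum degree δ.
-- Twelve vertices (TwelveVertices): with five pairs matched and the spare pair stuck,
-- deg u + deg v ≥ 10 makes each matched pair seen wholly by u, wholly by v, or by both at one
-- common "hub" vertex (the other one is its "tail"); parity yields a hub pair.  Moving u next to
-- a hub makes its tail the new u; two such moves rule out a pair seen by u alone (and, after
-- exchanging u and v, one seen by v alone).  If all five pairs are hub pairs, the moves show that
-- every hub sees every tail, so the hubs against u, v and the tails form a K_{5,7}.
module Submission where

open import Defs renaming (sym to Adj-sym)
open import Data.Bool using (Bool; true; false; not)
open import Data.Bool.Properties using (not-involutive; not-¬)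
open import Data.Empty using (⊥; ⊥-elim)
open import Data.Fin using (Fin; zero; suc; toℕ; fromℕ; fromℕ<; inject₁; combine; remQuot)
open import Data.Fin.Properties using (_≟_; toℕ<n; toℕ-injective; toℕ-inject₁; toℕ-fromℕ<; inject₁-injective; combine-injective; combine-remQuot; remQuot-combine)
open import Data.Fin.Permutation using (Permutation′; _⟨$⟩ʳ_; _⟨$⟩ˡ_; inverseˡ; inverseʳ; transpose; _∘ₚ_; id)
import Data.Fin.Permutation.Components as Components
open import Data.List using (filter; length; tabulate)
open import Data.Nat using (ℕ; zero; suc; _+_; _*_; _≤_; _<_; _<?_; z≤n; s≤s)
open import Data.Nat.Properties using (≤-refl; n≤1+n; ≤-trans; ≤-reflexive; ≤-antisym; <⇒≤; <⇒≱; <-irrefl; <-asym; ≤∧≢⇒<; +-mono-≤; +-monoˡ-≤; +-monoʳ-≤; +-cancelˡ-≤; +-cancelʳ-≤; +-assoc; +-suc; +-identityʳ; *-monoˡ-<; ≤⇒≤ᵇ; +-0-commutativeMonoid)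
open import Data.Nat.Tactic.RingSolver using (solve-∀)
open import Data.Product using (Σ; ∃₂; _×_; _,_; proj₁; proj₂; uncurry; map; map₂)
open import Data.Sum using (_⊎_; inj₁; inj₂; [_,_])
open import Function using (_∘_)
open import Relation.Nullary using (¬_; Dec; yes; no)
open import Relation.Nullary.Decidable using (dec-true; dec-false; _×-dec_)
open import Relation.Binary.PropositionalEquality using (_≡_; _≢_; refl; sym; trans; cong; cong₂; subst; subst₂; module ≡-Reasoning)
import Algebra.Properties.CommutativeMonoid.Sum as CommutativeMonoidSum

open CommutativeMonoidSum +-0-commutativeMonoid using (sum; sum-permute; ∑-distrib-+; sum-init-last)

count : ∀ {A : Set} → Dec A → ℕ
count (yes _) = 1
count (no _) = 0

count-yes : ∀ {A : Set} (a? : Dec A) → A → count a? ≡ 1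
count-yes (yes _) _ = refl
count-yes (no ¬a) a = ⊥-elim (¬a a)

count-no : ∀ {A : Set} (a? : Dec A) → ¬ A → count a? ≡ 0
count-no (yes a) ¬a = ⊥-elim (¬a a)
count-no (no _) _ = refl

count-exclusive : ∀ {A B : Set} (a? : Dec A) (b? : Dec B) → ¬ (A × B) → count a? + count b? ≤ 1
count-exclusive (yes a) (yes b) ¬ab = ⊥-elim (¬ab (a , b))
count-exclusive (yes _) (no _) _ = ≤-refl
count-exclusive (no _) (yes _) _ = ≤-refl
count-exclusive (no _) (no _) _ = z≤n

count-exactly-one : ∀ {A B : Set} (a? : Dec A) (b? : Dec B) → count a? + count b? ≡ 1 →
  (A × ¬ B) ⊎ (¬ A × B)
count-exactly-one (yes a) (no ¬b) _ = inj₁ (a , ¬b)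
count-exactly-one (no ¬a) (yes b) _ = inj₂ (¬a , b)
count-exactly-one (yes _) (yes _) ()
count-exactly-one (no _) (no _) ()

length-filter-tabulate : ∀ {n} {A : Set} {P : A → Set} (P? : ∀ a → Dec (P a)) (f : Fin n → A) →
  length (filter P? (tabulate f)) ≡ sum (λ i → count (P? (f i)))
length-filter-tabulate {zero} P? f = refl
length-filter-tabulate {suc n} P? f with P? (f zero)
... | yes _ = cong suc (length-filter-tabulate P? (f ∘ suc))
... | no _ = length-filter-tabulate P? (f ∘ suc)

sum-≤ : ∀ {m c} (f : Fin m → ℕ) → (∀ i → f i ≤ c) → sum f ≤ m * c
sum-≤ {zero} f _ = z≤n
sum-≤ {suc m} f f≤c = +-mono-≤ (f≤c zero) (sum-≤ (f ∘ suc) (f≤c ∘ suc))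

sum-≤-prefix : ∀ {n c} (f : Fin n → ℕ) k → (∀ i → toℕ i < k → f i ≤ c) → (∀ i → k ≤ toℕ i → f i ≡ 0) →
  sum f ≤ k * c
sum-≤-prefix {zero} f k _ _ = z≤n
sum-≤-prefix {suc n} {c} f zero _ vanish =
  +-mono-≤ (≤-reflexive (vanish zero z≤n))
           (sum-≤-prefix {c = c} (f ∘ suc) zero (λ _ ()) (λ i _ → vanish (suc i) z≤n))
sum-≤-prefix {suc n} f (suc k) small vanish =
  +-mono-≤ (small zero (s≤s z≤n))
           (sum-≤-prefix (f ∘ suc) k (λ i i<k → small (suc i) (s≤s i<k)) (λ i k≤i → vanish (suc i) (s≤s k≤i)))

+-saturated : ∀ {a b c d} → a ≤ c → b ≤ d → c + d ≤ a + b → a ≡ c × d ≤ b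
+-saturated {a} {b} {c} {d} a≤c b≤d full =
  ≤-antisym a≤c (+-cancelʳ-≤ d c a (≤-trans full (+-monoʳ-≤ a b≤d))) ,
  +-cancelˡ-≤ c d b (≤-trans full (+-monoˡ-≤ b a≤c))

head-and-tail : ∀ {m c} (f : Fin (suc m) → ℕ) → (∀ i → f i ≤ c) → suc m * c ≤ sum f →
  f zero ≡ c × m * c ≤ sum (f ∘ suc)
head-and-tail f f≤c full = +-saturated (f≤c zero) (sum-≤ (f ∘ suc) (f≤c ∘ suc)) full

sum-saturated : ∀ {m c} (f : Fin m → ℕ) → (∀ i → f i ≤ c) → m * c ≤ sum f → ∀ i → f i ≡ c
sum-saturated {suc m} f f≤c full zero = proj₁ (head-and-tail f f≤c full)
sum-saturated {suc m} f f≤c full (suc i) =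
  sum-saturated (f ∘ suc) (f≤c ∘ suc) (proj₂ (head-and-tail f f≤c full)) i

sum-split-evenly : ∀ {m} (f g : Fin m → ℕ) → (∀ i → (f i ≡ 2 × g i ≡ 0) ⊎ (f i ≡ 0 × g i ≡ 2)) →
  ∃₂ λ a b → a + b ≡ m × sum f ≡ a * 2 × sum g ≡ b * 2
sum-split-evenly {zero} f g _ = 0 , 0 , refl , refl , refl
sum-split-evenly {suc m} f g split with split zero | sum-split-evenly (f ∘ suc) (g ∘ suc) (split ∘ suc)
... | inj₁ (f₀≡2 , g₀≡0) | a , b , a+b≡m , Σf , Σg =
  suc a , b , cong suc a+b≡m , cong₂ _+_ f₀≡2 Σf , cong₂ _+_ g₀≡0 Σg
... | inj₂ (f₀≡0 , g₀≡2) | a , b , a+b≡m , Σf , Σg =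
  a , suc b , trans (+-suc a b) (cong suc a+b≡m) , cong₂ _+_ f₀≡0 Σf , cong₂ _+_ g₀≡2 Σg

odd-split : ∀ a b → a + b ≡ 5 → 5 ≤ a * 2 → 5 ≤ b * 2 → ⊥
odd-split 0 _ _ 5≤2a _ = ≤⇒≤ᵇ 5≤2a
odd-split 1 _ _ 5≤2a _ = ≤⇒≤ᵇ 5≤2a
odd-split 2 _ _ 5≤2a _ = ≤⇒≤ᵇ 5≤2a
odd-split 3 _ refl _ 5≤2b = ≤⇒≤ᵇ 5≤2b
odd-split 4 _ refl _ 5≤2b = ≤⇒≤ᵇ 5≤2b
odd-split 5 _ refl _ 5≤2b = ≤⇒≤ᵇ 5≤2b
odd-split (suc (suc (suc (suc (suc (suc _)))))) _ () _ _

both-one : ∀ {p q} → p ≤ 1 → q ≤ 1 → p + q ≡ 2 → p ≡ 1 × q ≡ 1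
both-one (s≤s z≤n) (s≤s z≤n) _ = refl , refl
both-one z≤n z≤n ()
both-one z≤n (s≤s z≤n) ()
both-one (s≤s z≤n) z≤n ()

+-cross : ∀ a b c d → (a + b) + (c + d) ≡ (a + d) + (b + c)
+-cross = solve-∀

double : ∀ m → m * 2 ≡ m + m
double = solve-∀

search : ∀ {m} {A B : Fin m → Set} → (∀ i → A i ⊎ B i) → Σ (Fin m) A ⊎ (∀ i → B i)
search {zero} _ = inj₂ λ ()
search {suc m} {A} {B} decide with decide zero | search {m} {A ∘ suc} {B ∘ suc} (decide ∘ suc)
... | inj₁ a | _ = inj₁ (zero , a)
... | inj₂ _ | inj₁ (i , a) = inj₁ (suc i , a)
... | inj₂ b | inj₂ bs = inj₂ λ { zero → b ; (suc i) → bs i }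

either-side : ∀ {A : Set} {P : Bool → Set} → (∀ c → A ⊎ P c) → A ⊎ (∀ c → P c)
either-side decide with decide true | decide false
... | inj₁ a | _ = inj₁ a
... | inj₂ _ | inj₁ a = inj₁ a
... | inj₂ p | inj₂ q = inj₂ λ { true → p ; false → q }

provided : ∀ {A B C : Set} → Dec A → (A → B ⊎ C) → B ⊎ (A → C)
provided (yes a) run with run a
... | inj₁ b = inj₁ b
... | inj₂ c = inj₂ (λ _ → c)
provided (no ¬a) _ = inj₂ (λ a → ⊥-elim (¬a a))

side : Bool → Fin 2
side true = zero
side false = suc zero

side⁻¹ : Fin 2 → Bool
side⁻¹ zero = true
side⁻¹ (suc zero) = false

side-side⁻¹ : ∀ s → side (side⁻¹ s) ≡ s
side-side⁻¹ zero = refl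
side-side⁻¹ (suc zero) = refl

side-injective : ∀ {b c} → side b ≡ side c → b ≡ c
side-injective {true} {true} _ = refl
side-injective {false} {false} _ = refl

module Slots (n : ℕ) where

  slot : Fin n → Bool → Fin (n * 2)
  slot i b = combine i (side b)

  unslot : Fin (n * 2) → Fin n × Bool
  unslot x = map₂ side⁻¹ (remQuot {n} 2 x)

  slot-unslot : (x : Fin (n * 2)) → uncurry slot (unslot x) ≡ x
  slot-unslot x = trans (cong (combine (proj₁ (remQuot {n} 2 x))) (side-side⁻¹ _)) (combine-remQuot {n} 2 x)

  unslot-slot : ∀ (i : Fin n) b → unslot (slot i b) ≡ (i , b)
  unslot-slot i true = cong (map₂ side⁻¹) (remQuot-combine i zero)
  unslot-slot i false = cong (map₂ side⁻¹) (remQuot-combine i (suc zero))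

  slot-injective : ∀ {i j : Fin n} {b c} → slot i b ≡ slot j c → i ≡ j × b ≡ c
  slot-injective {i} {j} {b} {c} eq = map₂ side-injective (combine-injective i (side b) j (side c) eq)

  slots-of-pairs-≢ : ∀ {i j : Fin n} b c → i ≢ j → slot i b ≢ slot j c
  slots-of-pairs-≢ _ _ i≢j = i≢j ∘ proj₁ ∘ slot-injective

  slots-of-sides-≢ : ∀ (i : Fin n) b → slot i b ≢ slot i (not b)
  slots-of-sides-≢ i b = not-¬ refl ∘ proj₂ ∘ slot-injective

  partner : Fin (n * 2) → Fin (n * 2)
  partner x = slot (proj₁ (unslot x)) (not (proj₂ (unslot x)))

  partner-slot : ∀ (i : Fin n) b → partner (slot i b) ≡ slot i (not b)
  partner-slot i b = cong (λ p → slot (proj₁ p) (not (proj₂ p))) (unslot-slot i b)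

  partner-involutive : (x : Fin (n * 2)) → partner (partner x) ≡ x
  partner-involutive x = begin
    partner (partner x)     ≡⟨ partner-slot i (not b) ⟩
    slot i (not (not b))    ≡⟨ cong (slot i) (not-involutive b) ⟩
    slot i b                ≡⟨ slot-unslot x ⟩
    x                       ∎
    where
    open ≡-Reasoning
    i : Fin n
    i = proj₁ (unslot x)
    b : Bool
    b = proj₂ (unslot x)

sum-slots : ∀ n (f : Fin (n * 2) → ℕ) →
  sum f ≡ sum (λ i → f (Slots.slot n i true) + f (Slots.slot n i false))
sum-slots zero f = refl
sum-slots (suc n) f =
  trans (sym (+-assoc (f zero) (f (suc zero)) _))
        (cong (f zero + f (suc zero) +_) (sum-slots n (λ x → f (suc (suc x)))))

transpose-left : ∀ {n} (s t : Fin n) → Components.transpose s t s ≡ t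
transpose-left s t rewrite dec-true (s ≟ s) refl = refl

transpose-right : ∀ {n} (s t : Fin n) → Components.transpose s t t ≡ s
transpose-right s t with t ≟ s
... | yes t≡s = t≡s
... | no _ rewrite dec-true (t ≟ t) refl = refl

transpose-other : ∀ {n} {s t x : Fin n} → x ≢ s → x ≢ t → Components.transpose s t x ≡ x
transpose-other {s = s} {t} {x} x≢s x≢t rewrite dec-false (x ≟ s) x≢s | dec-false (x ≟ t) x≢t = refl

-- How the two sides of a pair are seen from two vertices u and v (U b: u sees side b).  With
-- exactly two edges and no crossing, u sees both sides, or v does, or both see the same "hub" side.
data PairType (U V : Bool → Set) : Set where
  seen-by-u : U true → U false → ¬ V true → ¬ V false → PairType U V
  seen-by-v : ¬ U true → ¬ U false → V true → V false → PairType U V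
  hub : ∀ c → U c → ¬ U (not c) → V c → ¬ V (not c) → PairType U V

hub-forced : ∀ {U V : Bool → Set} → PairType U V → ∀ e → V e → ¬ V (not e) → U e × ¬ U (not e)
hub-forced (seen-by-u _ _ ¬vt _) true vt _ = ⊥-elim (¬vt vt)
hub-forced (seen-by-u _ _ _ ¬vf) false vf _ = ⊥-elim (¬vf vf)
hub-forced (seen-by-v _ _ _ vf) true _ ¬vf = ⊥-elim (¬vf vf)
hub-forced (seen-by-v _ _ vt _) false _ ¬vt = ⊥-elim (¬vt vt)
hub-forced (hub true ut ¬uf _ _) true _ _ = ut , ¬uf
hub-forced (hub false uf ¬ut _ _) false _ _ = uf , ¬ut
hub-forced (hub true _ _ _ ¬vf) false vf _ = ⊥-elim (¬vf vf)
hub-forced (hub false _ _ _ ¬vt) true vt _ = ⊥-elim (¬vt vt)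

seen-by-u-forced : ∀ {U V : Bool → Set} → PairType U V → ¬ V true → ¬ V false → U true × U false
seen-by-u-forced (seen-by-u ut uf _ _) _ _ = ut , uf
seen-by-u-forced (seen-by-v _ _ vt _) ¬vt _ = ⊥-elim (¬vt vt)
seen-by-u-forced (hub true _ _ vt _) ¬vt _ = ⊥-elim (¬vt vt)
seen-by-u-forced (hub false _ _ vf _) _ ¬vf = ⊥-elim (¬vf vf)

module PairedMatching {n : ℕ} (G : Graph (n * 2)) where

  open Slots n

  infix 4 _~_ _~?_

  _~_ : Fin (n * 2) → Fin (n * 2) → Set
  x ~ y = Adj G x y

  _~?_ : ∀ x y → Dec (x ~ y)
  _~?_ = adj? G

  ~-cong : ∀ {x x' y y'} → x ≡ x' → y ≡ y' → x ~ y → x' ~ y'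
  ~-cong = subst₂ _~_

  ≁-cong : ∀ {x x' y y'} → x ≡ x' → y ≡ y' → ¬ x ~ y → ¬ x' ~ y'
  ≁-cong x≡x' y≡y' ¬xy = ¬xy ∘ subst₂ _~_ (sym x≡x') (sym y≡y')

  -- A labelling puts the vertex π ⟨$⟩ʳ x into slot x.
  Labelling : Set
  Labelling = Permutation′ (n * 2)

  at : Labelling → Fin n → Bool → Fin (n * 2)
  at π i b = π ⟨$⟩ʳ slot i b

  Matched : Labelling → Fin n → Set
  Matched π i = at π i true ~ at π i false

  matched-from : ∀ π i b → at π i b ~ at π i (not b) → Matched π i
  matched-from _ _ true e = e
  matched-from _ _ false e = Adj-sym G e

  matched-sides : ∀ π i → Matched π i → ∀ b → at π i b ~ at π i (not b)
  matched-sides _ _ m true = m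
  matched-sides _ _ m false = Adj-sym G m

  MatchedBelow : Labelling → ℕ → Set
  MatchedBelow π k = ∀ i → toℕ i < k → Matched π i

  Matching : ℕ → Set
  Matching k = Σ Labelling λ π → MatchedBelow π k

  perfect-matching : ∀ π → MatchedBelow π n → PerfectMatching G
  perfect-matching π matched = mate , mate-involutive , mate-adjacent
    where
    open ≡-Reasoning
    mate : Fin (n * 2) → Fin (n * 2)
    mate w = π ⟨$⟩ʳ partner (π ⟨$⟩ˡ w)
    mate-involutive : ∀ w → mate (mate w) ≡ w
    mate-involutive w = begin
      π ⟨$⟩ʳ partner (π ⟨$⟩ˡ (π ⟨$⟩ʳ partner (π ⟨$⟩ˡ w)))  ≡⟨ cong (λ x → π ⟨$⟩ʳ partner x) (inverseˡ π) ⟩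
      π ⟨$⟩ʳ partner (partner (π ⟨$⟩ˡ w))                   ≡⟨ cong (π ⟨$⟩ʳ_) (partner-involutive _) ⟩
      π ⟨$⟩ʳ (π ⟨$⟩ˡ w)                                     ≡⟨ inverseʳ π ⟩
      w                                                     ∎
    slot-adjacent : ∀ x → π ⟨$⟩ʳ x ~ π ⟨$⟩ʳ partner x
    slot-adjacent x = subst (λ y → π ⟨$⟩ʳ y ~ π ⟨$⟩ʳ partner x) (slot-unslot x)
      (matched-sides π _ (matched (proj₁ (unslot x)) (toℕ<n _)) (proj₂ (unslot x)))
    mate-adjacent : ∀ w → w ~ mate w
    mate-adjacent w = subst (_~ mate w) (inverseʳ π) (slot-adjacent (π ⟨$⟩ˡ w))

  labelling-injective : ∀ (π : Labelling) {x y} → π ⟨$⟩ʳ x ≡ π ⟨$⟩ʳ y → x ≡ y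
  labelling-injective π eq = trans (sym (inverseˡ π)) (trans (cong (π ⟨$⟩ˡ_) eq) (inverseˡ π))

  exchange : Labelling → Fin (n * 2) → Fin (n * 2) → Labelling
  exchange π s t = transpose s t ∘ₚ π

  exchange-left : ∀ π s t → exchange π s t ⟨$⟩ʳ s ≡ π ⟨$⟩ʳ t
  exchange-left π s t = cong (π ⟨$⟩ʳ_) (transpose-left s t)

  exchange-right : ∀ π s t → exchange π s t ⟨$⟩ʳ t ≡ π ⟨$⟩ʳ s
  exchange-right π s t = cong (π ⟨$⟩ʳ_) (transpose-right s t)

  exchange-other : ∀ π {s t x} → x ≢ s → x ≢ t → exchange π s t ⟨$⟩ʳ x ≡ π ⟨$⟩ʳ x
  exchange-other π x≢s x≢t = cong (π ⟨$⟩ʳ_) (transpose-other x≢s x≢t)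

  exchange-elsewhere : ∀ π {i k l : Fin n} {c d} → l ≢ i → l ≢ k → ∀ e →
    at (exchange π (slot i c) (slot k d)) l e ≡ at π l e
  exchange-elsewhere π l≢i l≢k e = exchange-other π (slots-of-pairs-≢ e _ l≢i) (slots-of-pairs-≢ e _ l≢k)

  matched-elsewhere : ∀ π {i k l : Fin n} {c d} → l ≢ i → l ≢ k → Matched π l →
    Matched (exchange π (slot i c) (slot k d)) l
  matched-elsewhere π l≢i l≢k =
    ~-cong (sym (exchange-elsewhere π l≢i l≢k true)) (sym (exchange-elsewhere π l≢i l≢k false))

  below-suc : ∀ {l k : Fin n} → toℕ l < suc (toℕ k) → l ≢ k → toℕ l < toℕ k
  below-suc (s≤s l≤k) l≢k = ≤∧≢⇒< l≤k (l≢k ∘ toℕ-injective)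

  extend-by-edge : ∀ π {k : Fin n} → MatchedBelow π (toℕ k) → Matched π k → Matching (suc (toℕ k))
  extend-by-edge π {k} below edge = π , below'
    where
    below' : MatchedBelow π (suc (toℕ k))
    below' l l≤k with l ≟ k
    ... | yes refl = edge
    ... | no l≢k = below l (below-suc l≤k l≢k)

  -- Exchanging slot (i , c) with slot (k , d) makes pair k {π(i,c) , π(k,¬d)} and pair i
  -- {π(k,d) , π(i,¬c)}; if these are edges (the latter only when i < k), pair k joins the matching.
  extend-by-exchange : ∀ π {i k : Fin n} c d → i ≢ k → MatchedBelow π (toℕ k) →
    (toℕ i < toℕ k → at π k d ~ at π i (not c)) → at π i c ~ at π k (not d) → Matching (suc (toℕ k))
  extend-by-exchange π {i} {k} c d i≢k below new-i new-k = π' , below'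
    where
    π' : Labelling
    π' = exchange π (slot i c) (slot k d)
    move-to-i : at π' i c ≡ at π k d
    move-to-i = exchange-left π (slot i c) (slot k d)
    move-to-k : at π' k d ≡ at π i c
    move-to-k = exchange-right π (slot i c) (slot k d)
    keep-i : at π' i (not c) ≡ at π i (not c)
    keep-i = exchange-other π (slots-of-sides-≢ i c ∘ sym) (slots-of-pairs-≢ (not c) d i≢k)
    keep-k : at π' k (not d) ≡ at π k (not d)
    keep-k = exchange-other π (slots-of-pairs-≢ (not d) c (i≢k ∘ sym)) (slots-of-sides-≢ k d ∘ sym)
    below' : MatchedBelow π' (suc (toℕ k))
    below' l l≤k with l ≟ i | l ≟ k
    ... | yes refl | _ = matched-from π' l c (~-cong (sym move-to-i) (sym keep-i) (new-i (below-suc l≤k i≢k)))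
    ... | no _ | yes refl = matched-from π' l d (~-cong (sym move-to-k) (sym keep-k) new-k)
    ... | no l≢i | no l≢k = matched-elsewhere π l≢i l≢k (below l (below-suc l≤k l≢k))

  -- Obstructions to extending the matching at pair k = {u , v}, seen from pair i.
  -- No crossing: never u ~ π(i,c) together with v ~ π(i,¬c) (an exchange would use both edges).
  NoCross : Labelling → Fin n → Fin n → Set
  NoCross π k i = ∀ c → ¬ (at π k true ~ at π i c × at π k false ~ at π i (not c))

  NoEdge : Labelling → Fin n → Fin n → Set
  NoEdge π k i = ∀ b c → ¬ (at π k b ~ at π i c)

  record Stuck (π : Labelling) (k : Fin n) : Set where
    field
      unmatched : ¬ Matched π k
      no-cross : ∀ i → toℕ i < toℕ k → NoCross π k i
      no-edge : ∀ i → toℕ k < toℕ i → NoEdge π k i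

  -- A crossing with an earlier pair is undone by one exchange.
  probe-below : ∀ π {k i : Fin n} → MatchedBelow π (toℕ k) → toℕ i < toℕ k →
    Matching (suc (toℕ k)) ⊎ NoCross π k i
  probe-below π {k} {i} below i<k = either-side try
    where
    i≢k : i ≢ k
    i≢k i≡k = <-irrefl (cong toℕ i≡k) i<k
    try : ∀ c → Matching (suc (toℕ k)) ⊎ ¬ (at π k true ~ at π i c × at π k false ~ at π i (not c))
    try c with (at π k true ~? at π i c) ×-dec (at π k false ~? at π i (not c))
    ... | yes (u~ , v~) = inj₁ (extend-by-exchange π c false i≢k below (λ _ → v~) (Adj-sym G u~))
    ... | no ¬cross = inj₂ ¬cross

  -- An edge to a later pair is used by one exchange.
  probe-above : ∀ π {k i : Fin n} → MatchedBelow π (toℕ k) → toℕ k < toℕ i →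
    Matching (suc (toℕ k)) ⊎ NoEdge π k i
  probe-above π {k} {i} below k<i = either-side λ b → either-side (try b)
    where
    i≢k : i ≢ k
    i≢k i≡k = <-irrefl (cong toℕ (sym i≡k)) k<i
    try : ∀ b c → Matching (suc (toℕ k)) ⊎ ¬ (at π k b ~ at π i c)
    try b c with at π k b ~? at π i c
    ... | no ¬edge = inj₂ ¬edge
    ... | yes edge = inj₁ (extend-by-exchange π c (not b) i≢k below (λ i<k → ⊥-elim (<-asym i<k k<i))
                             (subst (λ e → at π i c ~ at π k e) (sym (not-involutive b)) (Adj-sym G edge)))

  augment : ∀ π k → MatchedBelow π (toℕ k) → Matching (suc (toℕ k)) ⊎ Stuck π k
  augment π k below with at π k true ~? at π k false
  ... | yes edge = inj₁ (extend-by-edge π below edge)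
  ... | no unmatched with search (λ i → provided (toℕ i <? toℕ k) (probe-below π below))
                          | search (λ i → provided (toℕ k <? toℕ i) (probe-above π below))
  ...   | inj₁ (_ , m) | _ = inj₁ m
  ...   | inj₂ _ | inj₁ (_ , m) = inj₁ m
  ...   | inj₂ no-cross | inj₂ no-edge =
    inj₂ record { unmatched = unmatched ; no-cross = no-cross ; no-edge = no-edge }

  links : Labelling → Fin (n * 2) → Fin n → ℕ
  links π w i = count (w ~? at π i true) + count (w ~? at π i false)

  edgesBetween : Labelling → Fin n → Fin n → ℕ
  edgesBetween π k i = links π (at π k true) i + links π (at π k false) i

  degree-by-pairs : ∀ π w → degree G w ≡ sum (links π w)
  degree-by-pairs π w = begin
    degree G w                                ≡⟨ length-filter-tabulate (w ~?_) (λ x → x) ⟩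
    sum (λ x → count (w ~? x))                ≡⟨ sum-permute (λ x → count (w ~? x)) π ⟩
    sum (λ x → count (w ~? (π ⟨$⟩ʳ x)))       ≡⟨ sum-slots n _ ⟩
    sum (links π w)                           ∎
    where open ≡-Reasoning

  pair-degrees : ∀ π k → degree G (at π k true) + degree G (at π k false) ≡ sum (edgesBetween π k)
  pair-degrees π k = trans (cong₂ _+_ (degree-by-pairs π _) (degree-by-pairs π _))
                           (sym (∑-distrib-+ (links π (at π k true)) (links π (at π k false))))

  links-both : ∀ π w i → (∀ c → w ~ at π i c) → links π w i ≡ 2
  links-both π w i both =
    cong₂ _+_ (count-yes (w ~? at π i true) (both true)) (count-yes (w ~? at π i false) (both false))

  links-none : ∀ π w i → (∀ c → ¬ w ~ at π i c) → links π w i ≡ 0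
  links-none π w i none =
    cong₂ _+_ (count-no (w ~? at π i true) (none true)) (count-no (w ~? at π i false) (none false))

  no-edge-within : ∀ {π k} → ¬ Matched π k → NoEdge π k k
  no-edge-within _ true true = irrefl G
  no-edge-within ¬m true false = ¬m
  no-edge-within ¬m false true = ¬m ∘ Adj-sym G
  no-edge-within _ false false = irrefl G

  edges-none : ∀ {π k i} → NoEdge π k i → edgesBetween π k i ≡ 0
  edges-none {π} {k} {i} none = cong₂ _+_ (links-none π _ i (none true)) (links-none π _ i (none false))

  PairTypeOf : Labelling → Fin n → Fin n → Set
  PairTypeOf π k i = PairType (λ b → at π k true ~ at π i b) (λ b → at π k false ~ at π i b)

  -- The four adjacencies between pair k = {u , v} and pair i = {x , y}, regrouped along the two
  -- diagonals {u~x , v~y} and {u~y , v~x} that a crossing would complete.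
  module Diagonals (π : Labelling) (k i : Fin n) where
    u~x? : Dec (at π k true ~ at π i true)
    u~x? = at π k true ~? at π i true

    u~y? : Dec (at π k true ~ at π i false)
    u~y? = at π k true ~? at π i false

    v~x? : Dec (at π k false ~ at π i true)
    v~x? = at π k false ~? at π i true

    v~y? : Dec (at π k false ~ at π i false)
    v~y? = at π k false ~? at π i false

    diagonal : ℕ
    diagonal = count u~x? + count v~y?

    antidiagonal : ℕ
    antidiagonal = count u~y? + count v~x?

    edges-by-diagonals : edgesBetween π k i ≡ diagonal + antidiagonal
    edges-by-diagonals = +-cross (count u~x?) (count u~y?) (count v~x?) (count v~y?)

    diagonal-≤ : NoCross π k i → diagonal ≤ 1
    diagonal-≤ nc = count-exclusive u~x? v~y? (nc true)

    antidiagonal-≤ : NoCross π k i → antidiagonal ≤ 1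
    antidiagonal-≤ nc = count-exclusive u~y? v~x? (nc false)

    edges-noncrossing : NoCross π k i → edgesBetween π k i ≤ 2
    edges-noncrossing nc = subst (_≤ 2) (sym edges-by-diagonals) (+-mono-≤ (diagonal-≤ nc) (antidiagonal-≤ nc))

    -- Exactly two edges: one on each diagonal, which leaves only the three pair types.
    classify : NoCross π k i → edgesBetween π k i ≡ 2 → PairTypeOf π k i
    classify nc two with both-one (diagonal-≤ nc) (antidiagonal-≤ nc) (trans (sym edges-by-diagonals) two)
    ... | one₁ , one₂ with count-exactly-one u~x? v~y? one₁ | count-exactly-one u~y? v~x? one₂
    ...   | inj₁ (ux , ¬vy) | inj₁ (uy , ¬vx) = seen-by-u ux uy ¬vx ¬vy
    ...   | inj₁ (ux , ¬vy) | inj₂ (¬uy , vx) = hub true ux ¬uy vx ¬vy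
    ...   | inj₂ (¬ux , vy) | inj₁ (uy , ¬vx) = hub false uy ¬ux vy ¬vx
    ...   | inj₂ (¬ux , vy) | inj₂ (¬uy , vx) = seen-by-v ¬ux ¬uy vx vy

  module StuckBounds {π : Labelling} {k : Fin n} (stuck : Stuck π k) where
    open Stuck stuck

    below-bound : ∀ i → toℕ i < toℕ k → edgesBetween π k i ≤ 2
    below-bound i i<k = Diagonals.edges-noncrossing π k i (no-cross i i<k)

    beyond-zero : ∀ i → toℕ k ≤ toℕ i → edgesBetween π k i ≡ 0
    beyond-zero i k≤i with i ≟ k
    ... | yes refl = edges-none {π} {k} {k} (no-edge-within {π} {k} unmatched)
    ... | no i≢k = edges-none {π} {k} {i} (no-edge i (≤∧≢⇒< k≤i (i≢k ∘ sym ∘ toℕ-injective)))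

    pair-degree-bound : degree G (at π k true) + degree G (at π k false) ≤ toℕ k * 2
    pair-degree-bound = subst (_≤ toℕ k * 2) (sym (pair-degrees π k))
      (sum-≤-prefix (edgesBetween π k) (toℕ k) below-bound beyond-zero)

  module Grow (δ : ℕ) (min-degree : MinDegree≥ G δ) where

    extend : ∀ π k → toℕ k < δ → MatchedBelow π (toℕ k) → Matching (suc (toℕ k))
    extend π k k<δ below with augment π k below
    ... | inj₁ m = m
    ... | inj₂ stuck = ⊥-elim (<⇒≱ (*-monoˡ-< 2 k<δ) (≤-trans degrees≥ (StuckBounds.pair-degree-bound stuck)))
      where
      u v : Fin (n * 2)
      u = at π k true
      v = at π k false
      degrees≥ : δ * 2 ≤ degree G u + degree G v
      degrees≥ = subst (_≤ degree G u + degree G v) (sym (double δ)) (+-mono-≤ (min-degree u) (min-degree v))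

    grow : ∀ k → k ≤ δ → k ≤ n → Matching k
    grow zero _ _ = id , λ _ ()
    grow (suc k) k<δ k<n with grow k (<⇒≤ k<δ) (<⇒≤ k<n) | fromℕ< k<n | toℕ-fromℕ< k<n
    ... | π , below | p | refl = extend π p k<δ below

module TwelveVertices (G : Graph 12) (min-degree : MinDegree≥ G 5) where

  open Slots 6
  open PairedMatching {6} G
  open Grow 5 min-degree

  ι : Fin 5 → Fin 6
  ι = inject₁

  spare : Fin 6
  spare = fromℕ 5

  ι<5 : ∀ j → toℕ (ι j) < 5
  ι<5 j = subst (_< 5) (sym (toℕ-inject₁ j)) (toℕ<n j)

  below-5-≢-spare : ∀ {l : Fin 6} → toℕ l < 5 → l ≢ spare
  below-5-≢-spare l<5 refl = <-irrefl refl l<5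

  ι≢spare : ∀ j → ι j ≢ spare
  ι≢spare j = below-5-≢-spare (ι<5 j)

  u v : Labelling → Fin 12
  u π = at π spare true
  v π = at π spare false

  U V : Labelling → Fin 5 → Bool → Set
  U π j b = u π ~ at π (ι j) b
  V π j b = v π ~ at π (ι j) b

  Hub : Labelling → Fin 5 → Bool → Set
  Hub π j c = U π j c × ¬ U π j (not c) × V π j c × ¬ V π j (not c)

  Tight : Labelling → Set
  Tight π = ¬ Matched π spare × (∀ j → PairType (U π j) (V π j))

  degree-spare : ∀ π → ¬ Matched π spare → ∀ b →
    degree G (at π spare b) ≡ sum (λ j → links π (at π spare b) (ι j))
  degree-spare π unmatched b = begin
    degree G w                            ≡⟨ degree-by-pairs π w ⟩
    sum (links π w)                       ≡⟨ sum-init-last (links π w) ⟩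
    sum (links π w ∘ ι) + links π w spare ≡⟨ cong (sum (links π w ∘ ι) +_) none-in-spare ⟩
    sum (links π w ∘ ι) + 0               ≡⟨ +-identityʳ _ ⟩
    sum (links π w ∘ ι)                   ∎
    where
    open ≡-Reasoning
    w : Fin 12
    w = at π spare b
    none-in-spare : links π w spare ≡ 0
    none-in-spare = links-none π w spare (no-edge-within {π} {spare} unmatched b)

  -- Stuck at the spare pair, deg u + deg v ≥ 10 forces exactly two edges from every matched pair.
  saturated : ∀ {π} → Stuck π spare → ∀ j → edgesBetween π spare (ι j) ≡ 2
  saturated {π} stuck = sum-saturated (edgesBetween π spare ∘ ι) (λ j → below-bound (ι j) (ι<5 j))
    (subst (10 ≤_) total (+-mono-≤ (min-degree (u π)) (min-degree (v π))))
    where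
    open StuckBounds stuck
    open ≡-Reasoning
    e : Fin 6 → ℕ
    e = edgesBetween π spare
    total : degree G (u π) + degree G (v π) ≡ sum (e ∘ ι)
    total = begin
      degree G (u π) + degree G (v π)  ≡⟨ pair-degrees π spare ⟩
      sum e                            ≡⟨ sum-init-last e ⟩
      sum (e ∘ ι) + e spare            ≡⟨ cong (sum (e ∘ ι) +_) (beyond-zero spare ≤-refl) ⟩
      sum (e ∘ ι) + 0                  ≡⟨ +-identityʳ _ ⟩
      sum (e ∘ ι)                      ∎

  settle : ∀ π → MatchedBelow π 5 → PerfectMatching G ⊎ Tight π
  settle π below with augment π spare below
  ... | inj₁ (π' , all-matched) = inj₁ (perfect-matching π' all-matched)
  ... | inj₂ stuck =
    inj₂ (unmatched , λ j → Diagonals.classify π spare (ι j) (no-cross (ι j) (ι<5 j)) (saturated stuck j))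
    where open Stuck stuck

  hub-or-one-sided : ∀ {π j} → PairType (U π j) (V π j) →
    Σ Bool (Hub π j) ⊎ ((links π (u π) (ι j) ≡ 2 × links π (v π) (ι j) ≡ 0) ⊎
                        (links π (u π) (ι j) ≡ 0 × links π (v π) (ι j) ≡ 2))
  hub-or-one-sided (hub c uc ¬u∁ vc ¬v∁) = inj₁ (c , uc , ¬u∁ , vc , ¬v∁)
  hub-or-one-sided {π} {j} (seen-by-u ut uf ¬vt ¬vf) =
    inj₂ (inj₁ (links-both π (u π) (ι j) (λ { true → ut ; false → uf }) ,
                links-none π (v π) (ι j) (λ { true → ¬vt ; false → ¬vf })))
  hub-or-one-sided {π} {j} (seen-by-v ¬ut ¬uf vt vf) =
    inj₂ (inj₂ (links-none π (u π) (ι j) (λ { true → ¬ut ; false → ¬uf }) ,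
                links-both π (v π) (ι j) (λ { true → vt ; false → vf })))

  -- Parity: without hub pairs deg u and deg v would be even numbers ≥ 5 adding up to 10.
  hub-exists : ∀ π → Tight π → Σ (Fin 5) λ j → Σ Bool (Hub π j)
  hub-exists π (unmatched , type) with search (λ j → hub-or-one-sided {π} {j} (type j))
  ... | inj₁ found = found
  ... | inj₂ one-sided with sum-split-evenly (links π (u π) ∘ ι) (links π (v π) ∘ ι) one-sided
  ...   | a , b , a+b≡5 , Σu , Σv = ⊥-elim (odd-split a b a+b≡5 (five≤ true a Σu) (five≤ false b Σv))
    where
    five≤ : ∀ s h → sum (links π (at π spare s) ∘ ι) ≡ h * 2 → 5 ≤ h * 2
    five≤ s _ eq = subst (5 ≤_) (trans (degree-spare π unmatched s) eq) (min-degree _)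

  -- Relocation: exchange u with the tail (side ¬c) of pair j, so that pair j becomes {hub , u}
  -- and the tail becomes the new u.
  module Relocate (π : Labelling) (j : Fin 5) (c : Bool) where
    π' : Labelling
    π' = exchange π (slot (ι j) (not c)) (slot spare true)

    tail : Fin 12
    tail = at π (ι j) (not c)

    new-u : u π' ≡ tail
    new-u = exchange-right π (slot (ι j) (not c)) (slot spare true)

    same-v : v π' ≡ v π
    same-v = exchange-other π (slots-of-pairs-≢ false (not c) (ι≢spare j ∘ sym))
                              (slots-of-sides-≢ spare true ∘ sym)

    same-hub : at π' (ι j) c ≡ at π (ι j) c
    same-hub = exchange-other π (slots-of-sides-≢ (ι j) c) (slots-of-pairs-≢ c true (ι≢spare j))

    same-elsewhere : ∀ {l} → l ≢ j → ∀ e → at π' (ι l) e ≡ at π (ι l) e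
    same-elsewhere {l} l≢j = exchange-elsewhere π (l≢j ∘ inject₁-injective) (ι≢spare l)

    still-matched : MatchedBelow π 5 → U π j c → MatchedBelow π' 5
    still-matched below u~hub l l<5 with l ≟ ι j
    ... | yes refl = matched-from π' (ι j) c (~-cong (sym same-hub) (sym old-u-here) (Adj-sym G u~hub))
      where
      old-u-here : at π' (ι j) (not c) ≡ u π
      old-u-here = exchange-left π (slot (ι j) (not c)) (slot spare true)
    ... | no l≢ιj = matched-elsewhere π l≢ιj (below-5-≢-spare l<5) (below l l<5)

    -- Tightness of π' transfers what v sees in other pairs into what the tail sees.
    tail-sees-hub : Tight π' → ∀ {l} → l ≢ j → ∀ e → V π l e → ¬ V π l (not e) →
      tail ~ at π (ι l) e × ¬ tail ~ at π (ι l) (not e)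
    tail-sees-hub (_ , type) {l} l≢j e ve ¬v∁ =
      map (~-cong new-u (same-elsewhere l≢j e)) (≁-cong new-u (same-elsewhere l≢j (not e)))
        (hub-forced (type l) e (~-cong (sym same-v) (sym (same-elsewhere l≢j e)) ve)
                               (≁-cong (sym same-v) (sym (same-elsewhere l≢j (not e))) ¬v∁))

    tail-sees-both : Tight π' → ∀ {l} → l ≢ j → ¬ V π l true → ¬ V π l false →
      tail ~ at π (ι l) true × tail ~ at π (ι l) false
    tail-sees-both (_ , type) {l} l≢j ¬vt ¬vf =
      map (~-cong new-u (same-elsewhere l≢j true)) (~-cong new-u (same-elsewhere l≢j false))
        (seen-by-u-forced (type l) (≁-cong (sym same-v) (sym (same-elsewhere l≢j true)) ¬vt)
                                   (≁-cong (sym same-v) (sym (same-elsewhere l≢j false)) ¬vf))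

  -- A pair i seen by u alone excludes a hub pair j: relocating u next to the hub of j makes
  -- its tail see y_i, while relocating u next to x_i makes y_i miss that tail.
  lonely-pair : ∀ π → MatchedBelow π 5 → ∀ i → U π i true → ¬ V π i true → ¬ V π i false →
    (Σ (Fin 5) λ j → Σ Bool (Hub π j)) → PerfectMatching G
  lonely-pair π below i u~x ¬v~x ¬v~y (j , c , u~h , _ , v~h , ¬v~t)
    with settle (Relocate.π' π j c) (Relocate.still-matched π j c below u~h)
       | settle (Relocate.π' π i true) (Relocate.still-matched π i true below u~x)
  ... | inj₁ pm | _ = pm
  ... | inj₂ _ | inj₁ pm = pm
  ... | inj₂ tight-j | inj₂ tight-i =
    ⊥-elim (proj₂ (Relocate.tail-sees-hub π i true tight-i (i≢j ∘ sym) c v~h ¬v~t)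
                  (Adj-sym G (proj₂ (Relocate.tail-sees-both π j c tight-j i≢j ¬v~x ¬v~y))))
    where
    v-misses-i : ∀ e → ¬ V π i e
    v-misses-i true = ¬v~x
    v-misses-i false = ¬v~y
    i≢j : i ≢ j
    i≢j refl = v-misses-i c v~h

  -- Exchanging u and v turns pairs seen by v alone into pairs seen by u alone.
  module SwapEnds (π : Labelling) where
    π' : Labelling
    π' = exchange π (slot spare true) (slot spare false)

    u-swapped : u π' ≡ v π
    u-swapped = exchange-left π (slot spare true) (slot spare false)

    v-swapped : v π' ≡ u π
    v-swapped = exchange-right π (slot spare true) (slot spare false)

    same-elsewhere : ∀ l e → at π' (ι l) e ≡ at π (ι l) e
    same-elsewhere l = exchange-elsewhere π (ι≢spare l) (ι≢spare l)

    still-matched : MatchedBelow π 5 → MatchedBelow π' 5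
    still-matched below l l<5 = matched-elsewhere π (below-5-≢-spare l<5) (below-5-≢-spare l<5) (below l l<5)

    U-from-V : ∀ {l e} → V π l e → U π' l e
    U-from-V {l} {e} = ~-cong (sym u-swapped) (sym (same-elsewhere l e))

    V-from-U : ∀ {l e} → U π l e → V π' l e
    V-from-U {l} {e} = ~-cong (sym v-swapped) (sym (same-elsewhere l e))

    ¬U-from-¬V : ∀ {l e} → ¬ V π l e → ¬ U π' l e
    ¬U-from-¬V {l} {e} = ≁-cong (sym u-swapped) (sym (same-elsewhere l e))

    ¬V-from-¬U : ∀ {l e} → ¬ U π l e → ¬ V π' l e
    ¬V-from-¬U {l} {e} = ≁-cong (sym v-swapped) (sym (same-elsewhere l e))

    hub-swapped : ∀ {j c} → Hub π j c → Hub π' j c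
    hub-swapped {j} {c} (u~h , ¬u~t , v~h , ¬v~t) =
      U-from-V {j} {c} v~h , ¬U-from-¬V {j} {not c} ¬v~t , V-from-U {j} {c} u~h , ¬V-from-¬U {j} {not c} ¬u~t

  lonely-pair-v : ∀ π → MatchedBelow π 5 → ∀ i → V π i true → ¬ U π i true → ¬ U π i false →
    (Σ (Fin 5) λ j → Σ Bool (Hub π j)) → PerfectMatching G
  lonely-pair-v π below i v~x ¬u~x ¬u~y (j , c , h) =
    lonely-pair π' (still-matched below) i
      (U-from-V {i} {true} v~x) (¬V-from-¬U {i} {true} ¬u~x) (¬V-from-¬U {i} {false} ¬u~y)
      (j , c , hub-swapped {j} {c} h)
    where open SwapEnds π

  -- If all matched pairs are hub pairs and every relocation stays tight, the five hubs are adjacent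
  -- to u, to v, to the tail of their own pair (matched) and to every other tail (relocation).
  module Biclique (π : Labelling) (below : MatchedBelow π 5) (hubs : ∀ j → Σ Bool (Hub π j))
                  (tight : ∀ j → Tight (Relocate.π' π j (proj₁ (hubs j)))) where
    hubSide : Fin 5 → Bool
    hubSide j = proj₁ (hubs j)

    hubSlot : Fin 5 → Fin 12
    hubSlot a = slot (ι a) (hubSide a)

    otherPair : Fin 7 → Fin 6
    otherPair zero = spare
    otherPair (suc zero) = spare
    otherPair (suc (suc j)) = ι j

    otherSide : Fin 7 → Bool
    otherSide zero = true
    otherSide (suc zero) = false
    otherSide (suc (suc j)) = not (hubSide j)

    otherSlot : Fin 7 → Fin 12
    otherSlot k = slot (otherPair k) (otherSide k)

    hubSlot-injective : ∀ {a b} → hubSlot a ≡ hubSlot b → a ≡ b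
    hubSlot-injective {a} {b} = inject₁-injective ∘ proj₁ ∘ slot-injective {ι a} {ι b}

    other-injective : ∀ k l → otherPair k ≡ otherPair l → otherSide k ≡ otherSide l → k ≡ l
    other-injective zero zero _ _ = refl
    other-injective zero (suc zero) _ ()
    other-injective zero (suc (suc j)) pairs _ = ⊥-elim (ι≢spare j (sym pairs))
    other-injective (suc zero) zero _ ()
    other-injective (suc zero) (suc zero) _ _ = refl
    other-injective (suc zero) (suc (suc j)) pairs _ = ⊥-elim (ι≢spare j (sym pairs))
    other-injective (suc (suc i)) zero pairs _ = ⊥-elim (ι≢spare i pairs)
    other-injective (suc (suc i)) (suc zero) pairs _ = ⊥-elim (ι≢spare i pairs)
    other-injective (suc (suc i)) (suc (suc j)) pairs _ = cong (λ x → suc (suc x)) (inject₁-injective pairs)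

    otherSlot-injective : ∀ {k l} → otherSlot k ≡ otherSlot l → k ≡ l
    otherSlot-injective {k} {l} eq = uncurry (other-injective k l) (slot-injective {otherPair k} {otherPair l} eq)

    disjoint : ∀ a k → hubSlot a ≢ otherSlot k
    disjoint a k eq with slot-injective {ι a} {otherPair k} eq
    disjoint a zero eq | ιa≡spare , _ = ι≢spare a ιa≡spare
    disjoint a (suc zero) eq | ιa≡spare , _ = ι≢spare a ιa≡spare
    disjoint a (suc (suc j)) eq | ιa≡ιj , sides with inject₁-injective {i = a} {j = j} ιa≡ιj
    ... | refl = not-¬ refl sides

    adjacent : ∀ a k → π ⟨$⟩ʳ hubSlot a ~ π ⟨$⟩ʳ otherSlot k
    adjacent a zero = Adj-sym G (proj₁ (proj₂ (hubs a)))
    adjacent a (suc zero) = Adj-sym G (proj₁ (proj₂ (proj₂ (proj₂ (hubs a)))))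
    adjacent a (suc (suc j)) with a ≟ j
    ... | yes refl = matched-sides π (ι a) (below (ι a) (ι<5 a)) (hubSide a)
    ... | no a≢j = Adj-sym G (proj₁ (Relocate.tail-sees-hub π j (hubSide j) (tight j) a≢j (hubSide a) v~h ¬v~t))
      where
      v~h : V π a (hubSide a)
      v~h = proj₁ (proj₂ (proj₂ (proj₂ (hubs a))))
      ¬v~t : ¬ V π a (not (hubSide a))
      ¬v~t = proj₂ (proj₂ (proj₂ (proj₂ (hubs a))))

    biclique : ContainsK G 5 7
    biclique = (λ a → π ⟨$⟩ʳ hubSlot a) , (λ k → π ⟨$⟩ʳ otherSlot k) ,
               (λ eq → hubSlot-injective (labelling-injective π eq)) ,
               (λ eq → otherSlot-injective (labelling-injective π eq)) ,
               (λ a k eq → disjoint a k (labelling-injective π eq)) , adjacent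

  all-hubs : ∀ π → MatchedBelow π 5 → (∀ j → Σ Bool (Hub π j)) → PerfectMatching G ⊎ ContainsK G 5 7
  all-hubs π below hubs with search (λ j → settle (relocated j) (relocated-matched j))
    where
    relocated : Fin 5 → Labelling
    relocated j = Relocate.π' π j (proj₁ (hubs j))
    relocated-matched : ∀ j → MatchedBelow (relocated j) 5
    relocated-matched j = Relocate.still-matched π j (proj₁ (hubs j)) below (proj₁ (proj₂ (hubs j)))
  ... | inj₁ (_ , pm) = inj₁ pm
  ... | inj₂ tight = inj₂ (Biclique.biclique π below hubs tight)

  sort-pair : ∀ {π j} → PairType (U π j) (V π j) →
    ((U π j true × ¬ V π j true × ¬ V π j false) ⊎ (V π j true × ¬ U π j true × ¬ U π j false)) ⊎
    Σ Bool (Hub π j)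
  sort-pair (seen-by-u ut _ ¬vt ¬vf) = inj₁ (inj₁ (ut , ¬vt , ¬vf))
  sort-pair (seen-by-v ¬ut ¬uf vt _) = inj₁ (inj₂ (vt , ¬ut , ¬uf))
  sort-pair (hub c uc ¬u∁ vc ¬v∁) = inj₂ (c , uc , ¬u∁ , vc , ¬v∁)

  perfect-or-biclique : PerfectMatching G ⊎ ContainsK G 5 7
  perfect-or-biclique with grow 5 ≤-refl (n≤1+n 5)
  ... | π , below with settle π below
  ...   | inj₁ pm = inj₁ pm
  ...   | inj₂ tight with search (λ j → sort-pair {π} {j} (proj₂ tight j))
  ...     | inj₁ (i , inj₁ (u~x , ¬v~x , ¬v~y)) = inj₁ (lonely-pair π below i u~x ¬v~x ¬v~y (hub-exists π tight))
  ...     | inj₁ (i , inj₂ (v~x , ¬u~x , ¬u~y)) = inj₁ (lonely-pair-v π below i v~x ¬u~x ¬u~y (hub-exists π tight))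
  ...     | inj₂ hubs = all-hubs π below hubs

lemma9 : (G : Graph 12) → MinDegree≥ G 5 → ¬ ContainsK G 5 7 → PerfectMatching G
lemma9 G min-degree no-biclique =
  [ (λ matching → matching) , (λ biclique → ⊥-elim (no-biclique biclique)) ]
    (TwelveVertices.perfect-or-biclique G min-degree)
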